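{- For every integer $n\geq 4$, if $G$ is any graph obtained from the complete graph $K_n$ by subdividing each edge at least once, then $G$ contains no dominating $K_4$-model.
   Context: A dominating $K_t$-model in a graph $G$ is a sequence $(T_1,\dots,T_t)$ of pairwise disjoint non-empty connected subgraphs of $G$ such that for all $1\le i<j\le t$, every vertex of $T_j$ has a neighbour in $T_i$. Subdividing an edge $uv$ means replacing it by a path from $u$ to $v$ whose internal vertices are new. -}

module Defs where

open import Data.Nat using (ℕ; zero; suc; _≤_; _+_)
open import Data.Fin using (Fin; toℕ; _<_)
open import Data.Product using (Σ; ∃; _×_)
open import Data.Sum using (_⊎_)
open import Relation.Binary.PropositionalEquality using (_≡_; _≢_)
open import Data.Empty using (⊥)

-- A graph given by a type of vertices and an adjacency relation (the graphs
-- we build below are symmetric and loopless by construction).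
record Graph : Set₁ where
  field
    Vertex : Set
    Adj    : Vertex → Vertex → Set
open Graph public

data WalkIn (G : Graph) (S : Vertex G → Set) : Vertex G → Vertex G → Set where
  here : ∀ {u} → S u → WalkIn G S u u
  step : ∀ {u v w} → S u → Adj G u v → WalkIn G S v w → WalkIn G S u w

ConnectedIn : (G : Graph) → (Vertex G → Set) → Set
ConnectedIn G S = ∀ u v → S u → S v → WalkIn G S u v

record DominatingModel (G : Graph) (t : ℕ) : Set₁ where
  field
    T         : Fin t → Vertex G → Set
    nonempty  : ∀ i → ∃ λ v → T i v
    disjoint  : ∀ i j → i ≢ j → ∀ v → T i v → T j v → ⊥
    connected : ∀ i → ConnectedIn G (T i)
    dominates : ∀ i j → i < j → ∀ v → T j v → ∃ λ u → T i u × Adj G v u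

-- Subdivision of K_n: branch vertices Fin n; for every pair i < j the edge ij
-- is replaced by a path  i - s(i,j,0) - ... - s(i,j,ℓ i j - 1) - j  with
-- ℓ i j new internal vertices.
module Subdivision (n : ℕ) (ℓ : Fin n → Fin n → ℕ) where

  data SV : Set where
    br  : Fin n → SV
    sub : (i j : Fin n) → i < j → Fin (ℓ i j) → SV

  data E : SV → SV → Set where
    e-first : ∀ i j (p : i < j) (k : Fin (ℓ i j)) → toℕ k ≡ 0 → E (br i) (sub i j p k)
    e-last  : ∀ i j (p : i < j) (k : Fin (ℓ i j)) → suc (toℕ k) ≡ ℓ i j → E (sub i j p k) (br j)
    e-mid   : ∀ i j (p : i < j) (k k' : Fin (ℓ i j)) → toℕ k' ≡ suc (toℕ k) →
              E (sub i j p k) (sub i j p k')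
    e-orig  : ∀ i j → i < j → ℓ i j ≡ 0 → E (br i) (br j)

  SAdj : SV → SV → Set
  SAdj u v = E u v ⊎ E v u

  SubdivK : Graph
  SubdivK = record { Vertex = SV ; Adj = SAdj }

{-# OPTIONS --safe #-}
module Submission where

-- Let v lie in the last part T₃ of a dominating K₄-model. Then v has neighbours in
-- T₀, T₁ and T₂, and its neighbour a in T₂ has neighbours in T₀, T₁ and T₃; by
-- disjointness of the parts, both v and a have three distinct neighbours. In a
-- subdivision every subdivision vertex has degree 2, so v and a are adjacent branch
-- vertices, i.e. some edge of Kₙ was left unsubdivided.

open import Defs
open import Data.Nat using (ℕ; _≤_; z<s; s<s)
open import Data.Nat.Properties using (suc-injective; 0≢1+n; 1+n≰n; <-irrefl)
open import Data.Fin using (Fin; _<_; #_)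
open import Data.Fin.Properties using (toℕ-injective; toℕ<n)
open import Data.Product using (∃; ∃₂; _×_; _,_)
open import Data.Sum using (_⊎_; inj₁; inj₂; swap)
open import Data.Empty using (⊥-elim)
open import Relation.Nullary using (¬_)
open import Relation.Binary.Definitions using (Symmetric)
open import Relation.Binary.PropositionalEquality using (_≡_; refl; sym; trans; cong; subst; subst₂; _≢_)

record Degree≥3 (G : Graph) (x : Vertex G) : Set where
  constructor degree≥3
  field
    {a b c} : Vertex G
    x∼a     : Adj G x a
    x∼b     : Adj G x b
    x∼c     : Adj G x c
    a≢b     : a ≢ b
    a≢c     : a ≢ c
    b≢c     : b ≢ c

module _ {G : Graph} {t : ℕ} (D : DominatingModel G t) where
  open DominatingModel D

  distinct-parts⇒distinct : ∀ {i j a b} → i ≢ j → T i a → T j b → a ≢ b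
  distinct-parts⇒distinct i≢j a∈Tᵢ b∈Tⱼ refl = disjoint _ _ i≢j _ a∈Tᵢ b∈Tⱼ

  neighbours-in-three-parts⇒degree≥3 :
    ∀ {i j k x a b c} → i ≢ j → i ≢ k → j ≢ k →
    T i a → T j b → T k c → Adj G x a → Adj G x b → Adj G x c → Degree≥3 G x
  neighbours-in-three-parts⇒degree≥3 i≢j i≢k j≢k a∈Tᵢ b∈Tⱼ c∈Tₖ x∼a x∼b x∼c =
    degree≥3 x∼a x∼b x∼c
      (distinct-parts⇒distinct i≢j a∈Tᵢ b∈Tⱼ)
      (distinct-parts⇒distinct i≢k a∈Tᵢ c∈Tₖ)
      (distinct-parts⇒distinct j≢k b∈Tⱼ c∈Tₖ)

dominatingK₄⇒adjacent-degree≥3 : {G : Graph} → Symmetric (Adj G) → DominatingModel G 4 →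
                                 ∃₂ λ u v → Adj G u v × Degree≥3 G u × Degree≥3 G v
dominatingK₄⇒adjacent-degree≥3 adj-sym D =
  let v , v∈T₃              = nonempty (# 3)
      a₀ , a₀∈T₀ , v∼a₀  = dominates (# 0) (# 3) z<s v v∈T₃
      a₁ , a₁∈T₁ , v∼a₁  = dominates (# 1) (# 3) (s<s z<s) v v∈T₃
      a₂ , a₂∈T₂ , v∼a₂  = dominates (# 2) (# 3) (s<s (s<s z<s)) v v∈T₃
      b₀ , b₀∈T₀ , a₂∼b₀ = dominates (# 0) (# 2) z<s a₂ a₂∈T₂
      b₁ , b₁∈T₁ , a₂∼b₁ = dominates (# 1) (# 2) (s<s z<s) a₂ a₂∈T₂
  in v , a₂ , v∼a₂
   , neighbours-in-three-parts⇒degree≥3 D (λ ()) (λ ()) (λ ()) a₀∈T₀ a₁∈T₁ a₂∈T₂ v∼a₀ v∼a₁ v∼a₂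
   , neighbours-in-three-parts⇒degree≥3 D (λ ()) (λ ()) (λ ()) b₀∈T₀ b₁∈T₁ v∈T₃ a₂∼b₀ a₂∼b₁ (adj-sym v∼a₂)
  where open DominatingModel D

module SubdivisionProperties (n : ℕ) (ℓ : Fin n → Fin n → ℕ) where
  open Subdivision n ℓ

  SAdj-sym : Symmetric SAdj
  SAdj-sym = swap

  sub-successor-unique : ∀ {i j p k u w} → E (sub i j p k) u → E (sub i j p k) w → u ≡ w
  sub-successor-unique (e-last _ _ _ _ _) (e-last _ _ _ _ _) = refl
  sub-successor-unique (e-last _ _ _ _ k+1≡ℓ) (e-mid _ _ _ _ k' k'≡k+1) =
    ⊥-elim (<-irrefl (trans k'≡k+1 k+1≡ℓ) (toℕ<n k'))
  sub-successor-unique (e-mid _ _ _ _ k' k'≡k+1) (e-last _ _ _ _ k+1≡ℓ) =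
    ⊥-elim (<-irrefl (trans k'≡k+1 k+1≡ℓ) (toℕ<n k'))
  sub-successor-unique (e-mid i j p _ _ k'≡k+1) (e-mid _ _ _ _ _ k''≡k+1) =
    cong (sub i j p) (toℕ-injective (trans k'≡k+1 (sym k''≡k+1)))

  sub-predecessor-unique : ∀ {i j p k u w} → E u (sub i j p k) → E w (sub i j p k) → u ≡ w
  sub-predecessor-unique (e-first _ _ _ _ _) (e-first _ _ _ _ _) = refl
  sub-predecessor-unique (e-first _ _ _ _ k≡0) (e-mid _ _ _ _ _ k≡k'+1) =
    ⊥-elim (0≢1+n (trans (sym k≡0) k≡k'+1))
  sub-predecessor-unique (e-mid _ _ _ _ _ k≡k'+1) (e-first _ _ _ _ k≡0) =
    ⊥-elim (0≢1+n (trans (sym k≡0) k≡k'+1))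
  sub-predecessor-unique (e-mid i j p _ _ k≡k'+1) (e-mid _ _ _ _ _ k≡k''+1) =
    cong (sub i j p) (toℕ-injective (suc-injective (trans (sym k≡k'+1) k≡k''+1)))

  sub-degree≤2 : ∀ {i j p k a b c} → let x = sub i j p k in
                 SAdj x a → SAdj x b → SAdj x c → a ≡ b ⊎ a ≡ c ⊎ b ≡ c
  sub-degree≤2 (inj₁ x→a) (inj₁ x→b) _          = inj₁ (sub-successor-unique x→a x→b)
  sub-degree≤2 (inj₂ a→x) (inj₂ b→x) _          = inj₁ (sub-predecessor-unique a→x b→x)
  sub-degree≤2 (inj₁ x→a) (inj₂ _)   (inj₁ x→c) = inj₂ (inj₁ (sub-successor-unique x→a x→c))
  sub-degree≤2 (inj₁ _)   (inj₂ b→x) (inj₂ c→x) = inj₂ (inj₂ (sub-predecessor-unique b→x c→x))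
  sub-degree≤2 (inj₂ _)   (inj₁ x→b) (inj₁ x→c) = inj₂ (inj₂ (sub-successor-unique x→b x→c))
  sub-degree≤2 (inj₂ a→x) (inj₁ _)   (inj₂ c→x) = inj₂ (inj₁ (sub-predecessor-unique a→x c→x))

  degree≥3⇒branch : ∀ {x} → Degree≥3 SubdivK x → ∃ λ m → x ≡ br m
  degree≥3⇒branch {br m} _ = m , refl
  degree≥3⇒branch {sub _ _ _ _} (degree≥3 x∼a x∼b x∼c a≢b a≢c b≢c)
    with sub-degree≤2 x∼a x∼b x∼c
  ... | inj₁ a≡b        = ⊥-elim (a≢b a≡b)
  ... | inj₂ (inj₁ a≡c) = ⊥-elim (a≢c a≡c)
  ... | inj₂ (inj₂ b≡c) = ⊥-elim (b≢c b≡c)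

  module _ (subdivided : ∀ i j → i < j → 1 ≤ ℓ i j) where

    no-branch-edge : ∀ {i j} → ¬ E (br i) (br j)
    no-branch-edge (e-orig i j p ℓ≡0) = 1+n≰n (subst (1 ≤_) ℓ≡0 (subdivided i j p))

    branches-nonadjacent : ∀ {i j} → ¬ SAdj (br i) (br j)
    branches-nonadjacent (inj₁ i→j) = no-branch-edge i→j
    branches-nonadjacent (inj₂ j→i) = no-branch-edge j→i

corollary6 : (n : ℕ) → 4 ≤ n → (ℓ : Fin n → Fin n → ℕ) →
             (∀ i j → i < j → 1 ≤ ℓ i j) →
             ¬ DominatingModel (Subdivision.SubdivK n ℓ) 4
corollary6 n _ ℓ subdivided D =
  let u , v , u∼v , deg-u , deg-v = dominatingK₄⇒adjacent-degree≥3 SAdj-sym D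
      _ , u≡br = degree≥3⇒branch deg-u
      _ , v≡br = degree≥3⇒branch deg-v
  in branches-nonadjacent subdivided (subst₂ SAdj u≡br v≡br u∼v)
  where
    open Subdivision n ℓ
    open SubdivisionProperties n ℓ
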